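{- Let $r,q,a,b$ be integers, all greater than $1$, with $q-1=ab$. Let $P=\{1,2,\dots,rq\}$ be partitioned into $r$ groups $G_1,\dots,G_r$, each of size $q$. For each $j\in\{1,\dots,r\}$ let $(G_j,\mathcal{P}_j)$ be a tactical configuration with parameters $(q,q,a,a)$, i.e. $\mathcal{P}_j$ consists of $q$ subsets of $G_j$ of size $a$ such that every point of $G_j$ lies in exactly $a$ of them. Label the blocks so that $\mathcal{P}_j=\{P_{j1},\dots,P_{jq}\}$, and put $B_i=P_{1i}\cup P_{2i}\cup\cdots\cup P_{ri}$ for $i=1,\dots,q$. (Thus each $B_i$ is an $ra$-subset of $P$ containing exactly one block of every $\mathcal{P}_j$, and each block of each $\mathcal{P}_j$ lies in exactly one $B_i$.) For each point $g\in P$, with $g\in G_h$, fix a partition $G_h\setminus\{g\}=X_{g1}\cup\cdots\cup X_{gb}$ with $|X_{gl}|=a$ for all $l$. For $1\le l\le b$ and $1\le j\le q$ define \[B_{gl,j}=X_{gl}\cup (B_j\setminus P_{hj}),\] let $\mathcal{B}_g$ be the family $\{B_{gl,j}: 1\le l\le b,\ 1\le j\le q\}$, and let $\mathcal{B}$ be the family (with multiplicity) of all $B_{gl,j}$ with $1\le g\le rq$, $1\le l\le b$, $1\le j\le q$. Then $(P,\mathcal{B})$ is a tactical configuration with parameters $(\bar v,\bar b,\bar k,\bar r)=(rq,\ rq^2b,\ ra,\ rq(q-1))$.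
   Context: A tactical configuration with parameters $(\bar v,\bar b,\bar k,\bar r)$ is a pair $(P,\mathcal{B})$ where $P$ is a set of $\bar v$ points and $\mathcal{B}$ is a family of $\bar b$ subsets of $P$ (blocks, counted with multiplicity), each of size $\bar k$, such that every point of $P$ lies in exactly $\bar r$ blocks (counted with multiplicity). -}

module Defs where

open import Data.Nat using (ℕ; _*_)
open import Data.Bool using (Bool)
open import Data.Fin using (Fin; _≟_)
open import Data.Fin.Subset using (Subset; _∈_; _⊆_; _∪_; _∩_; _─_; ⋃; ∣_∣; ⊥)
open import Data.Fin.Subset.Properties using (_∈?_)
open import Data.List using (List; length; filter; tabulate; concatMap; allFin)
open import Data.List.Relation.Unary.All using (All)
open import Data.Vec as Vec using ()
open import Relation.Nullary using (does; ¬_)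
open import Relation.Binary.PropositionalEquality using (_≡_)

-- A tactical configuration (S, ℬ) with parameters (v, b, k, r), where the point
-- set S is a subset of an ambient finite set Fin n and the family of blocks ℬ
-- is a list (so blocks are counted with multiplicity).
record Tactical {n : ℕ} (S : Subset n) (v b k r : ℕ) (ℬ : List (Subset n)) : Set where
  field
    numPoints  : ∣ S ∣ ≡ v
    numBlocks  : length ℬ ≡ b
    blocksInS  : All (_⊆ S) ℬ
    blockSize  : All (λ B → ∣ B ∣ ≡ k) ℬ
    pointDeg   : ∀ x → x ∈ S → length (filter (x ∈?_) ℬ) ≡ r

group : {n r : ℕ} → (Fin n → Fin r) → Fin r → Subset n
group grp j = Vec.tabulate (λ x → does (grp x ≟ j))

record IsPartition {n b : ℕ} (S : Subset n) (X : Fin b → Subset n) : Set where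
  field
    disjoint : ∀ l l' → ¬ (l ≡ l') → X l ∩ X l' ≡ ⊥
    cover    : ⋃ (tabulate X) ≡ S

bigBlock : {n r q : ℕ} → (Fin r → Fin q → Subset n) → Fin q → Subset n
bigBlock Pb i = ⋃ (tabulate (λ j → Pb j i))

newBlock : {n r q b : ℕ} → (Fin n → Fin r) → (Fin r → Fin q → Subset n)
         → (Fin n → Fin b → Subset n) → Fin n → Fin b → Fin q → Subset n
newBlock grp Pb X g l j = X g l ∪ (bigBlock Pb j ─ Pb (grp g) j)

allBlocks : {n r q b : ℕ} → (Fin n → Fin r) → (Fin r → Fin q → Subset n)
          → (Fin n → Fin b → Subset n) → List (Subset n)
allBlocks {n} {r} {q} {b} grp Pb X =
  concatMap (λ g → concatMap (λ l → tabulate (λ j → newBlock grp Pb X g l j)) (allFin b)) (allFin n)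

module Submission where

-- Everything is a double count of Boolean indicator functions.
-- Write h = grp g for the group of g.  A point x of the group of g lies in
-- B_{gl,j} = X_{gl} ∪ (B_j ∖ P_{hj}) iff it lies in X_{gl}; a point x of
-- another group lies in it iff it lies in P_{grp x, j}, the unique block of B_j
-- in the group of x.  Hence:
--   * |B_{gl,j}| + |P_{hj}| = |X_{gl}| + |B_j|, and |B_j| = ra, so |B_{gl,j}| = ra;
--   * for fixed g, the number of pairs (l, j) with x ∈ B_{gl,j} is q·[x ≠ g]
--     when g is in the group of x (the X_{gl} partition G_h ∖ {g}) and ab when
--     it is not (x lies in exactly a blocks of its own configuration).  With
--     q = ab + 1 both cases read  #{(l,j)} + q·[g = x] = ab + [g ∼ x], and
--     summing over g (the group of x has q points) shows that the degree
--     d(x) of x satisfies  d(x) + q = rq·ab + q, i.e. d(x) = rq(q - 1).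

open import Defs
open import Data.Nat using (ℕ; zero; suc; _+_; _*_; _∸_; _<_)
open import Data.Nat.Properties using (+-*-semiring; +-comm; +-identityʳ; *-comm; *-zeroʳ; *-identityʳ; +-cancelʳ-≡)
open import Data.Nat.Tactic.RingSolver using (solve-∀)
open import Data.Bool using (Bool; true; false; _∨_; _∧_; not)
open import Data.Bool.Properties using (∨-zeroʳ; ∨-identityʳ; ∧-identityʳ; ∧-zeroʳ; ∧-inverseʳ; ¬-not)
open import Data.Fin using (Fin; zero; suc; _≟_)
open import Data.Fin.Properties using (suc-injective)
open import Data.Fin.Subset using (Subset; _∈_; _⊆_; _∪_; _∩_; _─_; _-_; ⋃; ∣_∣; ⊥; ⊤; ⁅_⁆)
open import Data.Fin.Subset.Properties using (_∈?_; ⊆⊤; ∣⊤∣≡n; p─q⊆p)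
open import Data.Vec using ([]; _∷_; lookup)
open import Data.Vec.Properties using (lookup-zipWith; lookup-replicate; lookup∘tabulate; lookup⇒[]=; []=⇒lookup)
open import Data.List using (List; []; _++_; length; filter; tabulate; concatMap; allFin)
open import Data.List.Properties using (length-++; filter-++; length-tabulate)
open import Data.List.Relation.Unary.All using (All)
open import Data.List.Relation.Unary.All.Properties using (concat⁺; map⁺; tabulate⁺; tabulate⁻)
open import Relation.Nullary using (does; yes; no; contradiction)
open import Relation.Nullary.Decidable using (dec-true; dec-false)
open import Relation.Unary using (Decidable)
open import Relation.Binary.PropositionalEquality using (_≡_; _≢_; refl; sym; trans; cong; cong₂; subst; module ≡-Reasoning)
open import Algebra.Properties.Semiring.Sum +-*-semiring using (sum; sum-syntax; sum-cong-≗; sum-replicate-zero; ∑-distrib-+; ∑-comm; *-distribˡ-sum)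
open ≡-Reasoning

ind : Bool → ℕ
ind true  = 1
ind false = 0

ind-injective : ∀ {u v} → ind u ≡ ind v → u ≡ v
ind-injective {true}  {true}  _ = refl
ind-injective {false} {false} _ = refl

∑-const : ∀ n c → ∑[ i < n ] c ≡ n * c
∑-const zero    c = refl
∑-const (suc n) c = cong (c +_) (∑-const n c)

∑-zero : ∀ {n} (f : Fin n → ℕ) → (∀ i → f i ≡ 0) → sum f ≡ 0
∑-zero {n} f f≡0 = trans (sum-cong-≗ f≡0) (sum-replicate-zero n)

∑-single : ∀ {n} (f : Fin n → ℕ) k → (∀ i → i ≢ k → f i ≡ 0) → sum f ≡ f k
∑-single f zero    f≡0 = trans (cong (f zero +_) (∑-zero _ λ i → f≡0 (suc i) λ ())) (+-identityʳ _)
∑-single f (suc k) f≡0 =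
  trans (cong (_+ sum (λ i → f (suc i))) (f≡0 zero λ ()))
        (∑-single (λ i → f (suc i)) k λ i i≢k → f≡0 (suc i) (λ eq → i≢k (suc-injective eq)))

additive-concatMap : ∀ {a b} {A : Set a} {B : Set b} (φ : List A → ℕ) →
  φ [] ≡ 0 → (∀ xs ys → φ (xs ++ ys) ≡ φ xs + φ ys) →
  ∀ {n} (f : B → List A) (h : Fin n → B) →
  φ (concatMap f (tabulate h)) ≡ ∑[ i < n ] φ (f (h i))
additive-concatMap φ φ[] φ++ {zero}  f h = φ[]
additive-concatMap φ φ[] φ++ {suc n} f h =
  trans (φ++ (f (h zero)) _) (cong (φ (f (h zero)) +_) (additive-concatMap φ φ[] φ++ f (λ i → h (suc i))))

module _ {a p} {A : Set a} {P : A → Set p} (P? : Decidable P) where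

  count : List A → ℕ
  count xs = length (filter P? xs)

  count-++ : ∀ xs ys → count (xs ++ ys) ≡ count xs + count ys
  count-++ xs ys = trans (cong length (filter-++ P? xs ys)) (length-++ (filter P? xs))

  count-tabulate : ∀ {n} (f : Fin n → A) → count (tabulate f) ≡ ∑[ i < n ] ind (does (P? (f i)))
  count-tabulate {zero}  f = refl
  count-tabulate {suc n} f with does (P? (f zero))
  ... | true  = cong suc (count-tabulate (λ i → f (suc i)))
  ... | false = count-tabulate (λ i → f (suc i))

  count-concatMap : ∀ {b} {B : Set b} {n} (f : B → List A) (h : Fin n → B) →
    count (concatMap f (tabulate h)) ≡ ∑[ i < n ] count (f (h i))
  count-concatMap = additive-concatMap count refl count-++

∈?-lookup : ∀ {n} (x : Fin n) (p : Subset n) → does (x ∈? p) ≡ lookup p x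
∈?-lookup zero    (true  ∷ p) = refl
∈?-lookup zero    (false ∷ p) = refl
∈?-lookup (suc x) (_ ∷ p)     = ∈?-lookup x p

∣p∣≡∑ : ∀ {n} (p : Subset n) → ∣ p ∣ ≡ ∑[ x < n ] ind (lookup p x)
∣p∣≡∑ []          = refl
∣p∣≡∑ (true  ∷ p) = cong suc (∣p∣≡∑ p)
∣p∣≡∑ (false ∷ p) = ∣p∣≡∑ p

lookup-∪ : ∀ {n} (p q : Subset n) x → lookup (p ∪ q) x ≡ (lookup p x ∨ lookup q x)
lookup-∪ p q x = lookup-zipWith _∨_ x p q

lookup-∩ : ∀ {n} (p q : Subset n) x → lookup (p ∩ q) x ≡ (lookup p x ∧ lookup q x)
lookup-∩ p q x = lookup-zipWith _∧_ x p q

lookup-─ : ∀ {n} (p q : Subset n) x → lookup (p ─ q) x ≡ (lookup p x ∧ not (lookup q x))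
lookup-─ (true  ∷ p) (true  ∷ q) zero    = refl
lookup-─ (true  ∷ p) (false ∷ q) zero    = refl
lookup-─ (false ∷ p) (true  ∷ q) zero    = refl
lookup-─ (false ∷ p) (false ∷ q) zero    = refl
lookup-─ (_     ∷ p) (_     ∷ q) (suc x) = lookup-─ p q x

lookup-⁅⁆ : ∀ {n} (g x : Fin n) → lookup ⁅ g ⁆ x ≡ does (g ≟ x)
lookup-⁅⁆ zero    zero    = refl
lookup-⁅⁆ zero    (suc x) = lookup-replicate x false
lookup-⁅⁆ (suc g) zero    = refl
lookup-⁅⁆ (suc g) (suc x) = lookup-⁅⁆ g x

lookup-group : ∀ {n r} (grp : Fin n → Fin r) j x → lookup (group grp j) x ≡ does (grp x ≟ j)
lookup-group grp j x = lookup∘tabulate (λ y → does (grp y ≟ j)) x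

lookup-⋃-head : ∀ {n m u} (f : Fin (suc m) → Subset n) x → lookup (f zero) x ≡ u →
  lookup (⋃ (tabulate f)) x ≡ (u ∨ lookup (⋃ (tabulate (λ i → f (suc i)))) x)
lookup-⋃-head f x refl = lookup-∪ (f zero) _ x

⋃-intro : ∀ {n m} (f : Fin m → Subset n) x i → lookup (f i) x ≡ true → lookup (⋃ (tabulate f)) x ≡ true
⋃-intro f x zero    fᵢx = lookup-⋃-head f x fᵢx
⋃-intro f x (suc i) fᵢx = trans (lookup-⋃-head f x refl)
  (trans (cong (lookup (f zero) x ∨_) (⋃-intro (λ i → f (suc i)) x i fᵢx)) (∨-zeroʳ (lookup (f zero) x)))

∑-ind-⋃ : ∀ {n m} (f : Fin m → Subset n) x →
  (∀ i i' → i ≢ i' → lookup (f i) x ≡ true → lookup (f i') x ≡ false) →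
  ∑[ i < m ] ind (lookup (f i) x) ≡ ind (lookup (⋃ (tabulate f)) x)
∑-ind-⋃ {m = zero}  f x _ = cong ind (sym (lookup-replicate x false))
∑-ind-⋃ {m = suc m} f x atMostOne with lookup (f zero) x in f₀x
... | true  = trans (cong suc (∑-zero _ λ i → cong ind (atMostOne zero (suc i) (λ ()) f₀x)))
                    (cong ind (sym (lookup-⋃-head f x f₀x)))
... | false = trans (∑-ind-⋃ (λ i → f (suc i)) x λ i i' i≢i' → atMostOne (suc i) (suc i') (λ eq → i≢i' (suc-injective eq)))
                    (cong ind (sym (lookup-⋃-head f x f₀x)))

≟-sound : ∀ {n} {i j : Fin n} → does (i ≟ j) ≡ true → i ≡ j
≟-sound {i = i} {j} eq with i ≟ j
... | yes i≡j = i≡j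
... | no  _   = contradiction eq λ ()

∈-group : ∀ {n r} (grp : Fin n → Fin r) {j x} → x ∈ group grp j → grp x ≡ j
∈-group grp {j} {x} x∈G = ≟-sound (trans (sym (lookup-group grp j x)) ([]=⇒lookup x∈G))

∈-ownGroup : ∀ {n r} (grp : Fin n → Fin r) x → x ∈ group grp (grp x)
∈-ownGroup grp x = lookup⇒[]= x _ (trans (lookup-group grp (grp x) x) (dec-true (grp x ≟ grp x) refl))

lookup-punctured : ∀ {n r} (grp : Fin n → Fin r) j g x →
  lookup (group grp j - g) x ≡ (does (grp x ≟ j) ∧ not (does (g ≟ x)))
lookup-punctured grp j g x =
  trans (lookup-─ (group grp j) ⁅ g ⁆ x) (cong₂ (λ u v → u ∧ not v) (lookup-group grp j x) (lookup-⁅⁆ g x))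

partition-⊆ : ∀ {n m} {S : Subset n} {X : Fin m → Subset n} → IsPartition S X → ∀ l → X l ⊆ S
partition-⊆ {X = X} part l {x} x∈Xₗ =
  lookup⇒[]= x _ (subst (λ s → lookup s x ≡ true) (IsPartition.cover part) (⋃-intro X x l ([]=⇒lookup x∈Xₗ)))

partition-count : ∀ {n m} {S : Subset n} {X : Fin m → Subset n} → IsPartition S X →
  ∀ x → ∑[ l < m ] ind (lookup (X l) x) ≡ ind (lookup S x)
partition-count {X = X} part x =
  trans (∑-ind-⋃ X x atMostOne) (cong (λ s → ind (lookup s x)) (IsPartition.cover part))
  where
  atMostOne : ∀ l l' → l ≢ l' → lookup (X l) x ≡ true → lookup (X l') x ≡ false
  atMostOne l l' l≢l' x∈Xₗ = begin
    lookup (X l') x                   ≡⟨ cong (_∧ lookup (X l') x) x∈Xₗ ⟨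
    lookup (X l) x ∧ lookup (X l') x  ≡⟨ lookup-∩ (X l) (X l') x ⟨
    lookup (X l ∩ X l') x             ≡⟨ cong (λ s → lookup s x) (IsPartition.disjoint part l l' l≢l') ⟩
    lookup ⊥ x                        ≡⟨ lookup-replicate x false ⟩
    false                             ∎

module Construction {n r q b : ℕ} (grp : Fin n → Fin r) (Pb : Fin r → Fin q → Subset n)
  (X : Fin n → Fin b → Subset n)
  (Pb-local : ∀ j i → Pb j i ⊆ group grp j)
  (X-partition : ∀ g → IsPartition (group grp (grp g) - g) (X g)) where

  B : Fin n → Fin b → Fin q → Subset n
  B = newBlock grp Pb X

  X-local : ∀ g l → X g l ⊆ group grp (grp g)
  X-local g l x∈X = p─q⊆p _ ⁅ g ⁆ (partition-⊆ (X-partition g) l x∈X)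

  outside-group : ∀ {p : Subset n} {j x} → p ⊆ group grp j → grp x ≢ j → lookup p x ≡ false
  outside-group {p} {j} {x} p⊆G x∉G = ¬-not λ x∈p → x∉G (∈-group grp (p⊆G (lookup⇒[]= x p x∈p)))

  bigBlock-count : ∀ i x → ∑[ j < r ] ind (lookup (Pb j i) x) ≡ ind (lookup (bigBlock Pb i) x)
  bigBlock-count i x = ∑-ind-⋃ (λ j → Pb j i) x atMostOne
    where
    atMostOne : ∀ j j' → j ≢ j' → lookup (Pb j i) x ≡ true → lookup (Pb j' i) x ≡ false
    atMostOne j j' j≢j' x∈Pⱼ = outside-group (Pb-local j' i)
      λ x∈Gⱼ' → j≢j' (trans (sym (∈-group grp (Pb-local j i (lookup⇒[]= x _ x∈Pⱼ)))) x∈Gⱼ')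

  bigBlock-lookup : ∀ i x → lookup (bigBlock Pb i) x ≡ lookup (Pb (grp x) i) x
  bigBlock-lookup i x = ind-injective (begin
    ind (lookup (bigBlock Pb i) x)      ≡⟨ bigBlock-count i x ⟨
    ∑[ j < r ] ind (lookup (Pb j i) x)  ≡⟨ ∑-single _ (grp x) (λ j j≢ → cong ind (outside-group (Pb-local j i) (λ e → j≢ (sym e)))) ⟩
    ind (lookup (Pb (grp x) i) x)       ∎)

  ∣bigBlock∣ : ∀ {a} → (∀ j i → ∣ Pb j i ∣ ≡ a) → ∀ i → ∣ bigBlock Pb i ∣ ≡ r * a
  ∣bigBlock∣ {a} Pb-size i = begin
    ∣ bigBlock Pb i ∣                                ≡⟨ ∣p∣≡∑ (bigBlock Pb i) ⟩
    ∑[ x < n ] ind (lookup (bigBlock Pb i) x)        ≡⟨ sum-cong-≗ (bigBlock-count i) ⟨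
    ∑[ x < n ] ∑[ j < r ] ind (lookup (Pb j i) x)    ≡⟨ ∑-comm (λ x j → ind (lookup (Pb j i) x)) ⟩
    ∑[ j < r ] ∑[ x < n ] ind (lookup (Pb j i) x)    ≡⟨ sum-cong-≗ (λ j → trans (sym (∣p∣≡∑ (Pb j i))) (Pb-size j i)) ⟩
    ∑[ j < r ] a                                     ≡⟨ ∑-const r a ⟩
    r * a                                            ∎

  B-lookup : ∀ g l j x →
    lookup (B g l j) x ≡ (lookup (X g l) x ∨ (lookup (Pb (grp x) j) x ∧ not (lookup (Pb (grp g) j) x)))
  B-lookup g l j x = begin
    lookup (X g l ∪ (bigBlock Pb j ─ Pb (grp g) j)) x
      ≡⟨ lookup-∪ (X g l) _ x ⟩
    lookup (X g l) x ∨ lookup (bigBlock Pb j ─ Pb (grp g) j) x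
      ≡⟨ cong (lookup (X g l) x ∨_) (lookup-─ (bigBlock Pb j) _ x) ⟩
    lookup (X g l) x ∨ (lookup (bigBlock Pb j) x ∧ not (lookup (Pb (grp g) j) x))
      ≡⟨ cong (λ u → lookup (X g l) x ∨ (u ∧ not (lookup (Pb (grp g) j) x))) (bigBlock-lookup j x) ⟩
    lookup (X g l) x ∨ (lookup (Pb (grp x) j) x ∧ not (lookup (Pb (grp g) j) x))
      ∎

  B-sameGroup : ∀ g l j x → grp g ≡ grp x → lookup (B g l j) x ≡ lookup (X g l) x
  B-sameGroup g l j x same = begin
    lookup (B g l j) x
      ≡⟨ B-lookup g l j x ⟩
    lookup (X g l) x ∨ (lookup (Pb (grp x) j) x ∧ not (lookup (Pb (grp g) j) x))
      ≡⟨ cong (λ h → lookup (X g l) x ∨ (lookup (Pb (grp x) j) x ∧ not (lookup (Pb h j) x))) same ⟩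
    lookup (X g l) x ∨ (lookup (Pb (grp x) j) x ∧ not (lookup (Pb (grp x) j) x))
      ≡⟨ cong (lookup (X g l) x ∨_) (∧-inverseʳ (lookup (Pb (grp x) j) x)) ⟩
    lookup (X g l) x ∨ false
      ≡⟨ ∨-identityʳ (lookup (X g l) x) ⟩
    lookup (X g l) x
      ∎

  B-otherGroup : ∀ g l j x → grp g ≢ grp x → lookup (B g l j) x ≡ lookup (Pb (grp x) j) x
  B-otherGroup g l j x other = begin
    lookup (B g l j) x
      ≡⟨ B-lookup g l j x ⟩
    lookup (X g l) x ∨ (lookup (Pb (grp x) j) x ∧ not (lookup (Pb (grp g) j) x))
      ≡⟨ cong₂ (λ u v → u ∨ (lookup (Pb (grp x) j) x ∧ not v))
               (outside-group (X-local g l) (λ e → other (sym e)))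
               (outside-group (Pb-local (grp g) j) (λ e → other (sym e))) ⟩
    lookup (Pb (grp x) j) x ∧ true
      ≡⟨ ∧-identityʳ (lookup (Pb (grp x) j) x) ⟩
    lookup (Pb (grp x) j) x
      ∎

  -- Pointwise form of |B_{gl,j}| + |P_{hj}| = |X_{gl}| + |B_j|.
  B-indicator : ∀ g l j x →
    ind (lookup (B g l j) x) + ind (lookup (Pb (grp g) j) x) ≡ ind (lookup (X g l) x) + ind (lookup (bigBlock Pb j) x)
  B-indicator g l j x rewrite bigBlock-lookup j x with grp g ≟ grp x
  ... | yes same = cong₂ _+_ (cong ind (B-sameGroup g l j x same)) (cong (λ h → ind (lookup (Pb h j) x)) same)
  ... | no other = begin
    ind (lookup (B g l j) x) + ind (lookup (Pb (grp g) j) x)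
      ≡⟨ cong₂ _+_ (cong ind (B-otherGroup g l j x other))
                   (cong ind (outside-group (Pb-local (grp g) j) (λ e → other (sym e)))) ⟩
    ind (lookup (Pb (grp x) j) x) + 0
      ≡⟨ +-comm _ 0 ⟩
    0 + ind (lookup (Pb (grp x) j) x)
      ≡⟨ cong (λ u → ind u + ind (lookup (Pb (grp x) j) x)) (outside-group (X-local g l) (λ e → other (sym e))) ⟨
    ind (lookup (X g l) x) + ind (lookup (Pb (grp x) j) x)
      ∎

  ∣B∣ : ∀ {a} → (∀ j i → ∣ Pb j i ∣ ≡ a) → (∀ g l → ∣ X g l ∣ ≡ a) → ∀ g l j → ∣ B g l j ∣ ≡ r * a
  ∣B∣ {a} Pb-size X-size g l j = +-cancelʳ-≡ a _ _ (begin
    ∣ B g l j ∣ + a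
      ≡⟨ cong (∣ B g l j ∣ +_) (Pb-size (grp g) j) ⟨
    ∣ B g l j ∣ + ∣ Pb (grp g) j ∣
      ≡⟨ cong₂ _+_ (∣p∣≡∑ (B g l j)) (∣p∣≡∑ (Pb (grp g) j)) ⟩
    ∑[ x < n ] ind (lookup (B g l j) x) + ∑[ x < n ] ind (lookup (Pb (grp g) j) x)
      ≡⟨ ∑-distrib-+ (λ x → ind (lookup (B g l j) x)) (λ x → ind (lookup (Pb (grp g) j) x)) ⟨
    ∑[ x < n ] (ind (lookup (B g l j) x) + ind (lookup (Pb (grp g) j) x))
      ≡⟨ sum-cong-≗ (B-indicator g l j) ⟩
    ∑[ x < n ] (ind (lookup (X g l) x) + ind (lookup (bigBlock Pb j) x))
      ≡⟨ ∑-distrib-+ (λ x → ind (lookup (X g l) x)) (λ x → ind (lookup (bigBlock Pb j) x)) ⟩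
    ∑[ x < n ] ind (lookup (X g l) x) + ∑[ x < n ] ind (lookup (bigBlock Pb j) x)
      ≡⟨ cong₂ _+_ (∣p∣≡∑ (X g l)) (∣p∣≡∑ (bigBlock Pb j)) ⟨
    ∣ X g l ∣ + ∣ bigBlock Pb j ∣
      ≡⟨ cong₂ _+_ (X-size g l) (∣bigBlock∣ Pb-size j) ⟩
    a + r * a
      ≡⟨ +-comm a (r * a) ⟩
    r * a + a
      ∎)

  incidences : Fin n → Fin n → ℕ
  incidences g x = ∑[ l < b ] ∑[ j < q ] ind (lookup (B g l j) x)

  -- For g in the group of x, x ∈ B_{gl,j} for all j exactly when x ∈ X_{gl},
  -- and the X_{gl} partition G_h ∖ {g}.
  incidences-sameGroup : ∀ g x → grp g ≡ grp x → incidences g x ≡ q * ind (lookup (group grp (grp g) - g) x)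
  incidences-sameGroup g x same = begin
    ∑[ l < b ] ∑[ j < q ] ind (lookup (B g l j) x)
      ≡⟨ sum-cong-≗ (λ l → trans (sum-cong-≗ (λ j → cong ind (B-sameGroup g l j x same))) (∑-const q _)) ⟩
    ∑[ l < b ] (q * ind (lookup (X g l) x))
      ≡⟨ *-distribˡ-sum q (λ l → ind (lookup (X g l) x)) ⟨
    q * ∑[ l < b ] ind (lookup (X g l) x)
      ≡⟨ cong (q *_) (partition-count (X-partition g) x) ⟩
    q * ind (lookup (group grp (grp g) - g) x)
      ∎

  -- For g outside the group of x, x ∈ B_{gl,j} exactly when x ∈ P_{grp x, j}.
  incidences-otherGroup : ∀ {a} → (∀ x → ∑[ j < q ] ind (lookup (Pb (grp x) j) x) ≡ a) →
    ∀ g x → grp g ≢ grp x → incidences g x ≡ b * a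
  incidences-otherGroup {a} Pb-degree g x other = begin
    ∑[ l < b ] ∑[ j < q ] ind (lookup (B g l j) x)
      ≡⟨ sum-cong-≗ (λ l → trans (sum-cong-≗ (λ j → cong ind (B-otherGroup g l j x other))) (Pb-degree x)) ⟩
    ∑[ l < b ] a
      ≡⟨ ∑-const b a ⟩
    b * a
      ∎

  -- With q = ab + 1 the three cases g = x, g ∼ x with g ≠ x, and g ≁ x
  -- give incidences 0, q and ab, which all fit one formula.
  incidences-corrected : ∀ {a} → q ≡ suc (a * b) → (∀ x → ∑[ j < q ] ind (lookup (Pb (grp x) j) x) ≡ a) →
    ∀ x g → incidences g x + ind (does (g ≟ x)) * q ≡ a * b + ind (does (grp g ≟ grp x))
  incidences-corrected {a} q≡ Pb-degree x g with grp g ≟ grp x | g ≟ x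
  ... | yes same | yes refl = begin
    incidences x x + (q + 0)                    ≡⟨ cong₂ _+_ (incidences-sameGroup x x same) (+-identityʳ q) ⟩
    q * ind (lookup (group grp (grp x) - x) x) + q
      ≡⟨ cong (λ u → q * ind u + q) (trans (lookup-punctured grp (grp x) x x)
                                           (cong (λ d → does (grp x ≟ grp x) ∧ not d) (dec-true (x ≟ x) refl))) ⟩
    q * ind (does (grp x ≟ grp x) ∧ false) + q  ≡⟨ cong (λ u → q * ind u + q) (∧-zeroʳ _) ⟩
    q * 0 + q                                   ≡⟨ cong (_+ q) (*-zeroʳ q) ⟩
    q                                           ≡⟨ q≡ ⟩
    suc (a * b)                                 ≡⟨ +-comm 1 (a * b) ⟩
    a * b + 1                                   ∎
  ... | yes same | no distinct = begin
    incidences g x + 0                          ≡⟨ +-identityʳ _ ⟩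
    incidences g x                              ≡⟨ incidences-sameGroup g x same ⟩
    q * ind (lookup (group grp (grp g) - g) x)
      ≡⟨ cong (λ u → q * ind u) (trans (lookup-punctured grp (grp g) g x)
           (cong₂ (λ c d → c ∧ not d) (dec-true (grp x ≟ grp g) (sym same)) (dec-false (g ≟ x) distinct))) ⟩
    q * 1                                       ≡⟨ *-identityʳ q ⟩
    q                                           ≡⟨ q≡ ⟩
    suc (a * b)                                 ≡⟨ +-comm 1 (a * b) ⟩
    a * b + 1                                   ∎
  ... | no other | yes refl = contradiction refl other
  ... | no other | no _ = cong (_+ 0) (trans (incidences-otherGroup Pb-degree g x other) (*-comm b a))

  -- Every point lies in rq·ab of the new blocks: summing the corrected
  -- formula over g gives  Σ_g incidences g x + q = rq·ab + |G_{grp x}|.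
  degree : ∀ {a} → q ≡ suc (a * b) → (∀ j → ∣ group grp j ∣ ≡ q) →
    (∀ x → ∑[ j < q ] ind (lookup (Pb (grp x) j) x) ≡ a) →
    ∀ x → ∑[ g < n ] incidences g x ≡ n * (a * b)
  degree {a} q≡ G-size Pb-degree x = +-cancelʳ-≡ q _ _ (begin
    ∑[ g < n ] incidences g x + q
      ≡⟨ cong (∑[ g < n ] incidences g x +_) self ⟨
    ∑[ g < n ] incidences g x + ∑[ g < n ] (ind (does (g ≟ x)) * q)
      ≡⟨ ∑-distrib-+ (λ g → incidences g x) (λ g → ind (does (g ≟ x)) * q) ⟨
    ∑[ g < n ] (incidences g x + ind (does (g ≟ x)) * q)
      ≡⟨ sum-cong-≗ (incidences-corrected q≡ Pb-degree x) ⟩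
    ∑[ g < n ] (a * b + ind (does (grp g ≟ grp x)))
      ≡⟨ ∑-distrib-+ (λ _ → a * b) (λ g → ind (does (grp g ≟ grp x))) ⟩
    ∑[ g < n ] (a * b) + ∑[ g < n ] ind (does (grp g ≟ grp x))
      ≡⟨ cong₂ _+_ (∑-const n (a * b)) sameGroup ⟩
    n * (a * b) + q
      ∎)
    where
    self : ∑[ g < n ] (ind (does (g ≟ x)) * q) ≡ q
    self = trans (∑-single _ x λ g g≢x → cong (λ d → ind d * q) (dec-false (g ≟ x) g≢x))
                 (trans (cong (λ d → ind d * q) (dec-true (x ≟ x) refl)) (+-identityʳ q))
    sameGroup : ∑[ g < n ] ind (does (grp g ≟ grp x)) ≡ q
    sameGroup = trans (sum-cong-≗ (λ g → cong ind (sym (lookup-group grp (grp x) g))))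
                      (trans (sym (∣p∣≡∑ (group grp (grp x)))) (G-size (grp x)))

  blocksOf : Fin n → List (Subset n)
  blocksOf g = concatMap (λ l → tabulate (B g l)) (allFin b)

  allBlocks-count : ∀ x → count (x ∈?_) (allBlocks grp Pb X) ≡ ∑[ g < n ] incidences g x
  allBlocks-count x =
    trans (count-concatMap (x ∈?_) (blocksOf) (λ g → g)) (sum-cong-≗ λ g →
    trans (count-concatMap (x ∈?_) (λ l → tabulate (B g l)) (λ l → l)) (sum-cong-≗ λ l →
    trans (count-tabulate (x ∈?_) (B g l)) (sum-cong-≗ λ j → cong ind (∈?-lookup x (B g l j)))))

  allBlocks-length : length (allBlocks grp Pb X) ≡ n * (b * q)
  allBlocks-length =
    trans (length-concatMap blocksOf (λ g → g)) (trans (sum-cong-≗ λ g →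
    trans (length-concatMap (λ l → tabulate (B g l)) (λ l → l)) (trans (sum-cong-≗ λ l → length-tabulate (B g l)) (∑-const b q)))
    (∑-const n (b * q)))
    where
    length-concatMap : ∀ {A B : Set} {m} (f : B → List A) (h : Fin m → B) →
      length (concatMap f (tabulate h)) ≡ ∑[ i < m ] length (f (h i))
    length-concatMap = additive-concatMap length refl (λ xs ys → length-++ xs)

  allBlocks-All : ∀ {p} {P : Subset n → Set p} → (∀ g l j → P (B g l j)) → All P (allBlocks grp Pb X)
  allBlocks-All PB = concat⁺ (map⁺ (tabulate⁺ λ g → concat⁺ (map⁺ (tabulate⁺ λ l → tabulate⁺ (PB g l)))))

-- The theorem.
mainTheorem1 : (r q a b : ℕ) → 1 < r → 1 < q → 1 < a → 1 < b → q ∸ 1 ≡ a * b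
    → (grp : Fin (r * q) → Fin r) → (∀ j → ∣ group grp j ∣ ≡ q)
    → (Pb : Fin r → Fin q → Subset (r * q))
    → (∀ j → Tactical (group grp j) q q a a (tabulate (Pb j)))
    → (X : Fin (r * q) → Fin b → Subset (r * q))
    → (∀ g → IsPartition (group grp (grp g) - g) (X g))
    → (∀ g l → ∣ X g l ∣ ≡ a)
    → Tactical ⊤ (r * q) (r * q * q * b) (r * a) (r * q * (q ∸ 1)) (allBlocks grp Pb X)
mainTheorem1 r (suc q') a b _ _ _ _ q∸1≡ab grp G-size Pb tactical X X-partition X-size = record
  { numPoints = ∣⊤∣≡n (r * q)
  ; numBlocks = trans allBlocks-length (rearrange r q b)
  ; blocksInS = allBlocks-All λ _ _ _ → ⊆⊤
  ; blockSize = allBlocks-All (∣B∣ Pb-size X-size)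
  ; pointDeg  = λ x _ → begin
      count (x ∈?_) (allBlocks grp Pb X)  ≡⟨ allBlocks-count x ⟩
      ∑[ g < r * q ] incidences g x       ≡⟨ degree (cong suc q∸1≡ab) G-size Pb-degree x ⟩
      r * q * (a * b)                     ≡⟨ cong (r * q *_) q∸1≡ab ⟨
      r * q * (q ∸ 1)                     ∎
  }
  where
  q : ℕ
  q = suc q'
  Pb-local : ∀ j i → Pb j i ⊆ group grp j
  Pb-local j = tabulate⁻ {f = Pb j} (Tactical.blocksInS (tactical j))
  Pb-size : ∀ j i → ∣ Pb j i ∣ ≡ a
  Pb-size j = tabulate⁻ {f = Pb j} (Tactical.blockSize (tactical j))
  Pb-degree : ∀ x → ∑[ j < q ] ind (lookup (Pb (grp x) j) x) ≡ a
  Pb-degree x = trans (sum-cong-≗ λ j → cong ind (sym (∈?-lookup x (Pb (grp x) j))))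
    (trans (sym (count-tabulate (x ∈?_) (Pb (grp x))))
           (Tactical.pointDeg (tactical (grp x)) x (∈-ownGroup grp x)))
  open Construction grp Pb X Pb-local X-partition
  rearrange : ∀ r q b → r * q * (b * q) ≡ r * q * q * b
  rearrange = solve-∀
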